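{- Consider any allocation process satisfying conditions $\mathcal{P}_3$ and $\mathcal{W}_2$, or conditions $\mathcal{P}_2$ and $\mathcal{W}_3$. Then there is a constant $c>0$ (depending on $k_1,k_2,w_+,w_-$) such that for every round $t\ge0$, \[ p_-^t\cdot w_- - p_+^t\cdot w_+\ge \frac{c}{n}. \]
   Context: There are $n$ bins; $x^t$ is the load vector after round $t$, $W^t=\sum_ix_i^t$, $y_i^t=x_i^t-W^t/n$. $B_+^t=\{i:y_i^t\ge0\}$, $B_-^t=[n]\setminus B_+^t$, $\delta^t=|B_+^t|/n$. In each round, with bins labeled so that $y_1^t\ge\dots\ge y_n^t$, a bin $i$ is chosen according to a distribution $p^t$ (which may depend on the history); $p_+^t=\max_{i\in B_+^t}p_i^t$, $p_-^t=\min_{i\in B_-^t}p_i^t$. $\mathcal{P}_2$: $p_+^t\le1/n\le p_-^t$. $\mathcal{P}_3$: $\mathcal{P}_2$ plus constants $k_1,k_2\in(0,1]$ with $p_+^t\le \frac1n-\frac{k_1(1-\delta^t)}n$ and $p_-^t\ge\frac1n+\frac{k_2\delta^t}n$ for all $t$. $\mathcal{W}_2$: the chosen bin $i$ receives $w_-$ balls if $y_i^t<0$ and $w_+$ balls if $y_i^t\ge0$, where $1\le w_+\le w_-$ are constant integers. $\mathcal{W}_3$: $\mathcal{W}_2$ with $w_+<w_-$, and $p_i^t$ non-decreasing in $i$ for each $t$. -}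

module Defs where

open import Data.Nat as ℕ using (ℕ; zero; suc; NonZero)
open import Data.Fin using (Fin; zero; suc) renaming (_≤_ to _≤ᶠ_)
open import Data.Fin.Permutation using (Permutation′; _⟨$⟩ʳ_)
open import Data.Integer using (+_)
open import Data.Rational using (ℚ; 0ℚ; 1ℚ; _+_; _-_; _*_; _/_; _≤_; _<_; _≤?_)
open import Data.Product using (Σ; _×_)
open import Relation.Nullary using (yes; no)
open import Relation.Binary.PropositionalEquality using (_≡_)
open import Data.Fin using (_≟_)

ℕ→ℚ : ℕ → ℚ
ℕ→ℚ k = + k / 1

sumFin : (n : ℕ) → (Fin n → ℚ) → ℚ
sumFin zero    f = 0ℚ
sumFin (suc n) f = f zero + sumFin n (λ i → f (suc i))

module _ (n : ℕ) .{{_ : NonZero n}} where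

  inv : ℚ
  inv = + 1 / n

  W : (Fin n → ℕ) → ℚ
  W x = sumFin n (λ i → ℕ→ℚ (x i))

  y : (Fin n → ℕ) → Fin n → ℚ
  y x i = ℕ→ℚ (x i) - W x * inv

  InB₊ : (Fin n → ℕ) → Fin n → Set
  InB₊ x i = 0ℚ ≤ y x i

  InB₋ : (Fin n → ℕ) → Fin n → Set
  InB₋ x i = y x i < 0ℚ

  δ : (Fin n → ℕ) → ℚ
  δ x = sumFin n (λ i → indicator (0ℚ ≤? y x i)) * inv
    where
    indicator : ∀ {A : Set} → Relation.Nullary.Dec A → ℚ
    indicator (yes _) = 1ℚ
    indicator (no _)  = 0ℚ

  IsDistribution : (Fin n → ℚ) → Set
  IsDistribution p = (∀ i → 0ℚ ≤ p i) × (sumFin n p ≡ 1ℚ)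

  -- 𝒫₂ for one round (p₊ ≤ 1/n ≤ p₋, max/min written elementwise)
  P₂ : (Fin n → ℕ) → (Fin n → ℚ) → Set
  P₂ x p = (∀ i → InB₊ x i → p i ≤ inv) × (∀ i → InB₋ x i → inv ≤ p i)

  P₃ : ℚ → ℚ → (Fin n → ℕ) → (Fin n → ℚ) → Set
  P₃ k₁ k₂ x p =
    P₂ x p
    × (∀ i → InB₊ x i → p i ≤ inv - k₁ * (1ℚ - δ x) * inv)
    × (∀ i → InB₋ x i → inv + k₂ * δ x * inv ≤ p i)

  -- a labelling σ (σ a = bin with rank a) sorts bins so that y_{σ 0} ≥ y_{σ 1} ≥ …
  Sorts : (Fin n → ℕ) → Permutation′ n → Set
  Sorts x σ = ∀ a b → a ≤ᶠ b → y x (σ ⟨$⟩ʳ b) ≤ y x (σ ⟨$⟩ʳ a)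

  NonDecSorted : (Fin n → ℕ) → (Fin n → ℚ) → Set
  NonDecSorted x p = Σ (Permutation′ n) λ σ →
    Sorts x σ × (∀ a b → a ≤ᶠ b → p (σ ⟨$⟩ʳ a) ≤ p (σ ⟨$⟩ʳ b))

  weight : ℕ → ℕ → (Fin n → ℕ) → Fin n → ℕ
  weight w₊ w₋ x i with 0ℚ ≤? y x i
  ... | yes _ = w₊
  ... | no  _ = w₋

  step : ℕ → ℕ → (Fin n → ℕ) → Fin n → (Fin n → ℕ)
  step w₊ w₋ x j i with i ≟ j
  ... | yes _ = x i ℕ.+ weight w₊ w₋ x j
  ... | no  _ = x i

  -- a sample path of the process: x t = load after round t, chosen t = bin chosen in round t+1
  IsRun : ℕ → ℕ → (ℕ → Fin n → ℕ) → (ℕ → Fin n) → Set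
  IsRun w₊ w₋ x chosen =
    (∀ i → x 0 i ≡ 0) × (∀ t → x (suc t) ≡ step w₊ w₋ (x t) (chosen t))

-- With ι = 1/n, condition 𝒫₂ gives p₊ ≤ ι ≤ p₋. Under 𝒲₃ the weights differ by at least one,
-- so p₋ w₋ − p₊ w₊ ≥ ι (w₋ − w₊) ≥ ι. Under 𝒫₃ the probability gap itself is large:
-- p₋ − p₊ ≥ k₂ δ ι when δ ≥ ½ and p₋ − p₊ ≥ k₁ (1 − δ) ι when δ ≤ ½, so p₋ − p₊ ≥ ½ k₁ k₂ ι
-- either way, and w₋ ≥ w₊ ≥ 1 only enlarge it. Hence c = ½ k₁ k₂ (which is ≤ 1) works in both cases.
module Submission where

open import Defs
open import Data.Nat as ℕ using (ℕ; NonZero)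
open import Data.Fin using (Fin)
open import Data.Rational using (ℚ; 0ℚ; 1ℚ; _-_; _*_; _≤_; _<_)
open import Data.Product using (Σ; _×_; _,_)
open import Data.Sum using (_⊎_; inj₁; inj₂)
import Data.Nat.Coprimality as Coprimality
open import Data.Integer as ℤ using (+_)
import Data.Integer.Properties as ℤ
open import Data.Integer.Tactic.RingSolver using (solve-∀)
open import Data.Rational using (mkℚ; toℚᵘ; _+_; -_; ½; *≤*; nonNegative; positive)
open import Data.Rational.Properties
import Data.Rational.Unnormalised as ℚᵘ
import Data.Rational.Unnormalised.Properties as ℚᵘ
open import Data.Rational.Solver using (module +-*-Solver)
open import Relation.Binary.PropositionalEquality using (_≡_; refl; sym; cong)

open +-*-Solver using (solve; _:+_; _:-_; _:*_; _:=_; con)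

ℕ→ℚ≡mkℚ : ∀ k → ℕ→ℚ k ≡ mkℚ (+ k) 0 (Coprimality.sym (Coprimality.1-coprimeTo k))
ℕ→ℚ≡mkℚ k = normalize-coprime (Coprimality.sym (Coprimality.1-coprimeTo k))

ℕ→ℚ-nonNeg : ∀ k → 0ℚ ≤ ℕ→ℚ k
ℕ→ℚ-nonNeg k = nonNegative⁻¹ _ {{normalize-nonNeg k 1}}

ℕ→ℚ-mono-≤ : ∀ {m n} → m ℕ.≤ n → ℕ→ℚ m ≤ ℕ→ℚ n
ℕ→ℚ-mono-≤ {m} {n} m≤n rewrite ℕ→ℚ≡mkℚ m | ℕ→ℚ≡mkℚ n =
  *≤* (ℤ.*-monoʳ-≤-nonNeg (+ 1) (ℤ.+≤+ m≤n))

ℕ→ℚ-suc : ∀ k → ℕ→ℚ (ℕ.suc k) ≡ 1ℚ + ℕ→ℚ k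
ℕ→ℚ-suc k = toℚᵘ-injective (begin
  toℚᵘ (ℕ→ℚ (ℕ.suc k))           ≡⟨ cong toℚᵘ (ℕ→ℚ≡mkℚ (ℕ.suc k)) ⟩
  ℚᵘ.mkℚᵘ (+ ℕ.suc k) 0           ≈⟨ ℚᵘ.*≡* (cross-multiplied (+ k)) ⟩
  toℚᵘ 1ℚ ℚᵘ.+ ℚᵘ.mkℚᵘ (+ k) 0     ≡⟨ cong (λ q → toℚᵘ 1ℚ ℚᵘ.+ toℚᵘ q) (sym (ℕ→ℚ≡mkℚ k)) ⟩
  toℚᵘ 1ℚ ℚᵘ.+ toℚᵘ (ℕ→ℚ k)       ≈⟨ ℚᵘ.≃-sym (toℚᵘ-homo-+ 1ℚ (ℕ→ℚ k)) ⟩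
  toℚᵘ (1ℚ + ℕ→ℚ k)               ∎)
  where
  open ℚᵘ.≃-Reasoning
  cross-multiplied : ∀ i → (ℤ.1ℤ ℤ.+ i) ℤ.* ℤ.1ℤ ≡ (ℤ.1ℤ ℤ.* ℤ.1ℤ ℤ.+ i ℤ.* ℤ.1ℤ) ℤ.* ℤ.1ℤ
  cross-multiplied = solve-∀

inv-nonNeg : ∀ n .{{_ : NonZero n}} → 0ℚ ≤ inv n
inv-nonNeg n = <⇒≤ (positive⁻¹ _ {{normalize-pos 1 n}})

½*≤ : ∀ {k d} → k ≤ 1ℚ → ½ ≤ d → ½ * k ≤ d
½*≤ {k} {d} k≤1 ½≤d = begin
  ½ * k   ≤⟨ *-monoˡ-≤-nonNeg ½ k≤1 ⟩
  ½ * 1ℚ  ≡⟨ *-identityʳ ½ ⟩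
  ½       ≤⟨ ½≤d ⟩
  d       ∎
  where open ≤-Reasoning

½k₁k₂≤k₂*d : ∀ {k₁ k₂ d} → k₁ ≤ 1ℚ → 0ℚ ≤ k₂ → ½ ≤ d → ½ * k₁ * k₂ ≤ k₂ * d
½k₁k₂≤k₂*d {k₁} {k₂} {d} k₁≤1 0≤k₂ ½≤d = begin
  ½ * k₁ * k₂   ≡⟨ *-comm (½ * k₁) k₂ ⟩
  k₂ * (½ * k₁) ≤⟨ *-monoˡ-≤-nonNeg k₂ {{nonNegative 0≤k₂}} (½*≤ k₁≤1 ½≤d) ⟩
  k₂ * d        ∎
  where open ≤-Reasoning

½k₁k₂≤k₁*[1-d] : ∀ {k₁ k₂ d} → 0ℚ ≤ k₁ → k₂ ≤ 1ℚ → d ≤ ½ → ½ * k₁ * k₂ ≤ k₁ * (1ℚ - d)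
½k₁k₂≤k₁*[1-d] {k₁} {k₂} {d} 0≤k₁ k₂≤1 d≤½ = begin
  ½ * k₁ * k₂   ≡⟨ solve 2 (λ k₁ k₂ → con ½ :* k₁ :* k₂ := k₁ :* (con ½ :* k₂)) refl k₁ k₂ ⟩
  k₁ * (½ * k₂) ≤⟨ *-monoˡ-≤-nonNeg k₁ {{nonNegative 0≤k₁}} (½*≤ k₂≤1 ½≤1-d) ⟩
  k₁ * (1ℚ - d) ∎
  where
  open ≤-Reasoning
  ½≤1-d : ½ ≤ 1ℚ - d
  ½≤1-d = +-monoʳ-≤ 1ℚ (neg-antimono-≤ d≤½)

½k₁k₂≤1 : ∀ {k₁ k₂} → k₁ ≤ 1ℚ → 0ℚ ≤ k₂ → k₂ ≤ 1ℚ → ½ * k₁ * k₂ ≤ 1ℚ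
½k₁k₂≤1 {k₁} {k₂} k₁≤1 0≤k₂ k₂≤1 = begin
  ½ * k₁ * k₂ ≤⟨ ½k₁k₂≤k₂*d k₁≤1 0≤k₂ ½≤1 ⟩
  k₂ * 1ℚ     ≡⟨ *-identityʳ k₂ ⟩
  k₂          ≤⟨ k₂≤1 ⟩
  1ℚ          ∎
  where
  open ≤-Reasoning
  ½≤1 : ½ ≤ 1ℚ
  ½≤1 = *≤* (ℤ.+≤+ (ℕ.s≤s ℕ.z≤n))

𝒫₃-probability-gap : ∀ {k₁ k₂ d ι a b} → 0ℚ ≤ k₁ → k₁ ≤ 1ℚ → 0ℚ ≤ k₂ → k₂ ≤ 1ℚ → 0ℚ ≤ ι →
  b ≤ ι → ι ≤ a → b ≤ ι - k₁ * (1ℚ - d) * ι → ι + k₂ * d * ι ≤ a →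
  ½ * k₁ * k₂ * ι ≤ a - b
𝒫₃-probability-gap {k₁} {k₂} {d} {ι} {a} {b} 0≤k₁ k₁≤1 0≤k₂ k₂≤1 0≤ι b≤ι ι≤a b≤ι-k₁[1-d]ι ι+k₂dι≤a
  with ≤-total ½ d
... | inj₁ ½≤d = begin
  ½ * k₁ * k₂ * ι           ≤⟨ *-monoʳ-≤-nonNeg ι {{nonNegative 0≤ι}} (½k₁k₂≤k₂*d k₁≤1 0≤k₂ ½≤d) ⟩
  k₂ * d * ι                ≡⟨ solve 3 (λ k₂ d ι → k₂ :* d :* ι := (ι :+ k₂ :* d :* ι) :- ι) refl k₂ d ι ⟩
  (ι + k₂ * d * ι) - ι      ≤⟨ +-mono-≤ ι+k₂dι≤a (neg-antimono-≤ b≤ι) ⟩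
  a - b                     ∎
  where open ≤-Reasoning
... | inj₂ d≤½ = begin
  ½ * k₁ * k₂ * ι             ≤⟨ *-monoʳ-≤-nonNeg ι {{nonNegative 0≤ι}} (½k₁k₂≤k₁*[1-d] 0≤k₁ k₂≤1 d≤½) ⟩
  k₁ * (1ℚ - d) * ι           ≡⟨ solve 3 (λ k₁ d ι → k₁ :* (con 1ℚ :- d) :* ι := ι :- (ι :- k₁ :* (con 1ℚ :- d) :* ι)) refl k₁ d ι ⟩
  ι - (ι - k₁ * (1ℚ - d) * ι) ≤⟨ +-mono-≤ ι≤a (neg-antimono-≤ b≤ι-k₁[1-d]ι) ⟩
  a - b                       ∎
  where open ≤-Reasoning

gap≤weighted-gap : ∀ {a b u v} → 0ℚ ≤ a → b ≤ a → 1ℚ ≤ u → u ≤ v → a - b ≤ a * v - b * u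
gap≤weighted-gap {a} {b} {u} {v} 0≤a b≤a 1≤u u≤v = begin
  a - b           ≡⟨ sym (*-identityʳ (a - b)) ⟩
  (a - b) * 1ℚ    ≤⟨ *-monoˡ-≤-nonNeg (a - b) {{nonNegative 0≤a-b}} 1≤u ⟩
  (a - b) * u     ≡⟨ solve 3 (λ a b u → (a :- b) :* u := a :* u :- b :* u) refl a b u ⟩
  a * u - b * u   ≤⟨ +-monoˡ-≤ (- (b * u)) (*-monoˡ-≤-nonNeg a {{nonNegative 0≤a}} u≤v) ⟩
  a * v - b * u   ∎
  where
  open ≤-Reasoning
  0≤a-b : 0ℚ ≤ a - b
  0≤a-b = begin
    0ℚ    ≡⟨ sym (+-inverseʳ b) ⟩
    b - b ≤⟨ +-monoˡ-≤ (- b) b≤a ⟩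
    a - b ∎

threshold≤weighted-gap : ∀ {ι a b u v} → 0ℚ ≤ ι → b ≤ ι → ι ≤ a → 0ℚ ≤ u → 0ℚ ≤ v → 1ℚ + u ≤ v →
  ι ≤ a * v - b * u
threshold≤weighted-gap {ι} {a} {b} {u} {v} 0≤ι b≤ι ι≤a 0≤u 0≤v 1+u≤v = begin
  ι                    ≡⟨ solve 2 (λ ι u → ι := ι :* (con 1ℚ :+ u) :- ι :* u) refl ι u ⟩
  ι * (1ℚ + u) - ι * u ≤⟨ +-monoˡ-≤ (- (ι * u)) (*-monoˡ-≤-nonNeg ι {{nonNegative 0≤ι}} 1+u≤v) ⟩
  ι * v - ι * u        ≤⟨ +-mono-≤ (*-monoʳ-≤-nonNeg v {{nonNegative 0≤v}} ι≤a)
                                   (neg-antimono-≤ (*-monoʳ-≤-nonNeg u {{nonNegative 0≤u}} b≤ι)) ⟩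
  a * v - b * u        ∎
  where open ≤-Reasoning

0<½k₁k₂ : ∀ {k₁ k₂} → 0ℚ < k₁ → 0ℚ < k₂ → 0ℚ < ½ * k₁ * k₂
0<½k₁k₂ {k₁} {k₂} 0<k₁ 0<k₂ =
  positive⁻¹ _ {{pos*pos⇒pos (½ * k₁) {{pos*pos⇒pos ½ k₁ {{positive 0<k₁}}}} k₂ {{positive 0<k₂}}}}

*-inv≤inv : ∀ n .{{_ : NonZero n}} {c} → c ≤ 1ℚ → c * inv n ≤ inv n
*-inv≤inv n c≤1 = ≤-trans (*-monoʳ-≤-nonNeg (inv n) {{nonNegative (inv-nonNeg n)}} c≤1)
                          (≤-reflexive (*-identityˡ (inv n)))

module _ (n : ℕ) .{{_ : NonZero n}} (x : Fin n → ℕ) (p : Fin n → ℚ) {i j : Fin n} where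

  𝒫₃𝒲₂-weighted-gap : ∀ {k₁ k₂ w₊ w₋} → 0ℚ ≤ k₁ → k₁ ≤ 1ℚ → 0ℚ ≤ k₂ → k₂ ≤ 1ℚ →
    P₃ n k₁ k₂ x p → 1 ℕ.≤ w₊ → w₊ ℕ.≤ w₋ → InB₋ n x i → InB₊ n x j →
    ½ * k₁ * k₂ * inv n ≤ p i * ℕ→ℚ w₋ - p j * ℕ→ℚ w₊
  𝒫₃𝒲₂-weighted-gap {k₁} {k₂} {w₊} {w₋} 0≤k₁ k₁≤1 0≤k₂ k₂≤1 ((p₊≤ι , ι≤p₋) , p₊≤ι-k₁[1-δ]ι , ι+k₂δι≤p₋)
                    1≤w₊ w₊≤w₋ i∈B₋ j∈B₊ = begin
    ½ * k₁ * k₂ * inv n           ≤⟨ 𝒫₃-probability-gap 0≤k₁ k₁≤1 0≤k₂ k₂≤1 (inv-nonNeg n) pⱼ≤ι ι≤pᵢ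
                                       (p₊≤ι-k₁[1-δ]ι j j∈B₊) (ι+k₂δι≤p₋ i i∈B₋) ⟩
    p i - p j                     ≤⟨ gap≤weighted-gap (≤-trans (inv-nonNeg n) ι≤pᵢ) (≤-trans pⱼ≤ι ι≤pᵢ)
                                       (ℕ→ℚ-mono-≤ 1≤w₊) (ℕ→ℚ-mono-≤ w₊≤w₋) ⟩
    p i * ℕ→ℚ w₋ - p j * ℕ→ℚ w₊   ∎
    where
    open ≤-Reasoning
    ι≤pᵢ = ι≤p₋ i i∈B₋
    pⱼ≤ι = p₊≤ι j j∈B₊

  𝒫₂𝒲₃-weighted-gap : ∀ {w₊ w₋} → P₂ n x p → w₊ ℕ.< w₋ → InB₋ n x i → InB₊ n x j →
    inv n ≤ p i * ℕ→ℚ w₋ - p j * ℕ→ℚ w₊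
  𝒫₂𝒲₃-weighted-gap {w₊} {w₋} (p₊≤ι , ι≤p₋) w₊<w₋ i∈B₋ j∈B₊ =
    threshold≤weighted-gap (inv-nonNeg n) (p₊≤ι j j∈B₊) (ι≤p₋ i i∈B₋)
      (ℕ→ℚ-nonNeg w₊) (ℕ→ℚ-nonNeg w₋) 1+w₊≤w₋
    where
    1+w₊≤w₋ : 1ℚ + ℕ→ℚ w₊ ≤ ℕ→ℚ w₋
    1+w₊≤w₋ rewrite sym (ℕ→ℚ-suc w₊) = ℕ→ℚ-mono-≤ w₊<w₋

mainTheorem7 : (k₁ k₂ : ℚ) → 0ℚ < k₁ → k₁ ≤ 1ℚ → 0ℚ < k₂ → k₂ ≤ 1ℚ →
    (w₊ w₋ : ℕ) →
    Σ ℚ λ c → 0ℚ < c ×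
      ((n : ℕ) .{{_ : NonZero n}} →
       (x : ℕ → Fin n → ℕ) → (chosen : ℕ → Fin n) → (p : ℕ → Fin n → ℚ) →
       IsRun n w₊ w₋ x chosen →
       (∀ t → IsDistribution n (p t)) →
       (((∀ t → P₃ n k₁ k₂ (x t) (p t)) × (1 ℕ.≤ w₊ × w₊ ℕ.≤ w₋))
        ⊎ ((∀ t → P₂ n (x t) (p t)) × (1 ℕ.≤ w₊ × w₊ ℕ.< w₋)
           × (∀ t → NonDecSorted n (x t) (p t)))) →
       ∀ t → ∀ i j → InB₋ n (x t) i → InB₊ n (x t) j →
       c * inv n ≤ p t i * ℕ→ℚ w₋ - p t j * ℕ→ℚ w₊)
mainTheorem7 k₁ k₂ 0<k₁ k₁≤1 0<k₂ k₂≤1 w₊ w₋ = ½ * k₁ * k₂ , 0<½k₁k₂ 0<k₁ 0<k₂ , λ where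
  n x _ p _ _ (inj₁ (𝒫₃-always , 1≤w₊ , w₊≤w₋)) t i j i∈B₋ j∈B₊ →
    𝒫₃𝒲₂-weighted-gap n (x t) (p t) (<⇒≤ 0<k₁) k₁≤1 (<⇒≤ 0<k₂) k₂≤1 (𝒫₃-always t) 1≤w₊ w₊≤w₋ i∈B₋ j∈B₊
  n x _ p _ _ (inj₂ (𝒫₂-always , (_ , w₊<w₋) , _)) t i j i∈B₋ j∈B₊ →
    ≤-trans (*-inv≤inv n (½k₁k₂≤1 k₁≤1 (<⇒≤ 0<k₂) k₂≤1))
            (𝒫₂𝒲₃-weighted-gap n (x t) (p t) (𝒫₂-always t) w₊<w₋ i∈B₋ j∈B₊)
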